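{- For every graph $G=(V,E)$ with $n$ vertices, $h(G,2)=\tfrac12\bigl(n+BSS(G)\bigr)$.
   Context: For $X\subseteq V$, $N(X)$ is the set of vertices with a neighbor in $X$. $BSS(G)$ is the minimum of $|C|-|D|$ over all partitions $(A,B,C,D)$ of $V$ with $|A|=|B|$, $N(D)\subseteq C$, $N(A)\subseteq A\cup C$ and $N(B)\subseteq B\cup C$. Given $W_1,\dots,W_l\subseteq V$, the rabbit territory is $R_1=V\setminus W_1$, $R_t=N(R_{t-1})\setminus W_t$ for $t\ge2$; $h(G,l)$ is the minimum $k$ such that there exist $W_1,\dots,W_l$ with $|W_t|\le k$ for all $t$ and $R_l=\emptyset$. -}

module Defs where

open import Data.Bool using (Bool; true; false; _∧_; _∨_)
open import Data.Nat using (ℕ; zero; suc; _≤_)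
open import Data.Integer as ℤ using (ℤ; +_)
open import Data.Fin using (Fin; zero; suc)
open import Data.Fin.Subset using (Subset; ⊥; ⊤; ∁; _∩_; _∪_; _─_; _⊆_; ∣_∣)
open import Data.Vec using (Vec; []; _∷_; lookup; tabulate)
open import Data.Vec.Relation.Unary.All using (All)
open import Data.Product using (Σ; _×_; ∃)
open import Relation.Binary.PropositionalEquality using (_≡_)
open import Data.Empty renaming (⊥ to Empty)

record Graph (n : ℕ) : Set where
  field
    adj    : Fin n → Fin n → Bool
    sym    : ∀ u v → adj u v ≡ adj v u
    irrefl : ∀ v → adj v v ≡ false
open Graph public

anyF : ∀ {n} → (Fin n → Bool) → Bool
anyF {zero}  f = false
anyF {suc n} f = f zero ∨ anyF (λ i → f (suc i))

N : ∀ {n} → Graph n → Subset n → Subset n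
N G X = tabulate (λ v → anyF (λ u → lookup X u ∧ adj G u v))

-- rabbit territory: given R_{t-1} and the remaining shots W_t, W_{t+1}, ...,
-- iterate R_t = N(R_{t-1}) \ W_t
territory : ∀ {n m} → Graph n → Subset n → Vec (Subset n) m → Subset n
territory G R []       = R
territory G R (W ∷ Ws) = territory G (N G R ─ W) Ws

-- k hunters suffice in l = suc m rounds: W_1 (head) and W_2..W_l (Ws),
-- each of size ≤ k, with R_1 = V \ W_1 and R_l = ∅.
HunterWins : ∀ {n} → Graph n → (l : ℕ) → ℕ → Set
HunterWins {n} G zero    k = Empty  -- h(G,l) is only defined for l ≥ 1
HunterWins {n} G (suc m) k =
  Σ (Subset n) λ W₁ → Σ (Vec (Subset n) m) λ Ws →
    (∣ W₁ ∣ ≤ k) × All (λ W → ∣ W ∣ ≤ k) Ws × (territory G (∁ W₁) Ws ≡ ⊥)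

IsMinℕ : (ℕ → Set) → ℕ → Set
IsMinℕ P k = P k × (∀ m → P m → k ≤ m)

IsMinℤ : (ℤ → Set) → ℤ → Set
IsMinℤ P k = P k × (∀ m → P m → k ℤ.≤ m)

IsH : ∀ {n} → Graph n → ℕ → ℕ → Set
IsH G l k = IsMinℕ (HunterWins G l) k

BSSPartition : ∀ {n} → Graph n → (A B C D : Subset n) → Set
BSSPartition G A B C D =
  (A ∩ B ≡ ⊥) × (A ∩ C ≡ ⊥) × (A ∩ D ≡ ⊥) × (B ∩ C ≡ ⊥) × (B ∩ D ≡ ⊥) × (C ∩ D ≡ ⊥) ×
  (A ∪ B ∪ C ∪ D ≡ ⊤) ×
  (∣ A ∣ ≡ ∣ B ∣) ×
  (N G D ⊆ C) × (N G A ⊆ A ∪ C) × (N G B ⊆ B ∪ C)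

BSSValue : ∀ {n} → Graph n → ℤ → Set
BSSValue {n} G b = Σ (Subset n) λ A → Σ (Subset n) λ B → Σ (Subset n) λ C → Σ (Subset n) λ D →
  BSSPartition G A B C D × (b ≡ + ∣ C ∣ ℤ.- + ∣ D ∣)

IsBSS : ∀ {n} → Graph n → ℤ → Set
IsBSS G b = IsMinℤ (BSSValue G) b

{-# OPTIONS --safe #-}
-- A two-round strategy (W₁, W₂) of the hunter wins iff no edge joins V ∖ W₁ to V ∖ W₂, a
-- condition symmetric in W₁ and W₂. Hence, when |W₁| = |W₂| = k, the Venn cells A = W₁ ∖ W₂,
-- B = W₂ ∖ W₁, C = W₁ ∩ W₂, D = V ∖ (W₁ ∪ W₂) form an admissible BSS partition, and
-- inclusion–exclusion gives 2k + |D| = n + |C|. Conversely an admissible partition (A, B, C, D)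
-- gives the winning strategy (A ∪ C, B ∪ C) with two shots of size k = |A| + |C|; its Venn cells
-- C′ ⊆ C and D′ ⊇ D show 2k + |D| ≤ n + |C|. An optimal strategy, padded to two shots of size
-- exactly h(G,2), thus realises the minimum of |C| − |D|, which equals 2h(G,2) − n.
module Submission where

open import Defs
open import Data.Nat using (ℕ)
open import Data.Integer using (ℤ; +_; _+_; _*_)
open import Data.Product using (Σ; _×_)
open import Relation.Binary.PropositionalEquality using (_≡_)

open import Data.Bool using (Bool; true; false; _∧_; _∨_)
open import Data.Bool.Properties using (∨-zeroʳ)
open import Data.Fin using (Fin; zero; suc)
open import Data.Fin.Subset
  using (Subset; inside; outside; _∈_; _∉_; _⊆_; _─_; _∩_; _∪_; ∁; ⊥; ⊤; ∣_∣)
open import Data.Fin.Subset.Properties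
  using ( _∈?_; ∈⊤; ∉⊥; ⊆⊤; s⊆s; ⊆-antisym; Empty-unique; x∈∁p⇒x∉p; x∉p⇒x∈∁p; p⊆q⇒∁p⊇∁q
        ; x∈p∩q⁺; x∈p∩q⁻; p∩q⊆p; p∩q⊆q; ∩-comm; x∈p∪q⁺; x∈p∪q⁻; p⊆p∪q; q⊆p∪q
        ; x∈p∧x∉q⇒x∈p─q; p─q⊆p; ∣p∣≤n; ∣⊥∣≡0; ∣⊤∣≡n; ∣∁p∣≡n∸∣p∣; p⊆q⇒∣p∣≤∣q∣ )
open import Data.Integer as ℤ using (_-_; _⊖_)
import Data.Integer.Properties as ℤ
open import Data.Nat as ℕ using (zero; suc; _≤_; z≤n; s≤s; _⊔_)
import Data.Nat.Properties as ℕ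
open import Data.Product using (∃; ∃₂; _,_; proj₁; proj₂)
open import Data.Sum using (_⊎_; inj₁; inj₂; [_,_]′)
import Data.Sum as Sum
open import Data.Vec using ([]; _∷_; here; there)
open import Data.Vec.Properties using (lookup∘tabulate; []=⇒lookup; lookup⇒[]=)
open import Data.Vec.Relation.Unary.All using ([]; _∷_)
open import Function using (id; _∘_)
open import Relation.Binary.PropositionalEquality as ≡
  using (refl; trans; cong; cong₂; subst; module ≡-Reasoning)
open import Relation.Nullary using (yes; no; contradiction)

private
  variable
    n : ℕ
    x : Fin n
    p q : Subset n

x∈p─q⇒x∉q : x ∈ p ─ q → x ∉ q
x∈p─q⇒x∉q {p = inside ∷ p} {outside ∷ q} here ()
x∈p─q⇒x∉q {p = _ ∷ p}      {_ ∷ q}       (there x∈p─q) (there x∈q) = x∈p─q⇒x∉q x∈p─q x∈q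

p─q⊆∁q : p ─ q ⊆ ∁ q
p─q⊆∁q x∈p─q = x∉p⇒x∈∁p (x∈p─q⇒x∉q x∈p─q)

p⊆q⇒p─q≡⊥ : p ⊆ q → p ─ q ≡ ⊥
p⊆q⇒p─q≡⊥ {p = p} {q} p⊆q =
  Empty-unique λ (x , x∈p─q) → x∈p─q⇒x∉q x∈p─q (p⊆q (p─q⊆p p q x∈p─q))

p─q≡⊥⇒p⊆q : p ─ q ≡ ⊥ → p ⊆ q
p─q≡⊥⇒p⊆q {q = q} p─q≡⊥ {x} x∈p with x ∈? q
... | yes x∈q = x∈q
... | no  x∉q = contradiction (subst (x ∈_) p─q≡⊥ (x∈p∧x∉q⇒x∈p─q x∈p x∉q)) ∉⊥

p∩q≡⊥∧x∈p⇒x∉q : p ∩ q ≡ ⊥ → x ∈ p → x ∉ q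
p∩q≡⊥∧x∈p⇒x∉q {x = x} p∩q≡⊥ x∈p x∈q = ∉⊥ (subst (x ∈_) p∩q≡⊥ (x∈p∩q⁺ (x∈p , x∈q)))

disjoint⇒p∩q≡⊥ : (∀ {x} → x ∈ p → x ∉ q) → p ∩ q ≡ ⊥
disjoint⇒p∩q≡⊥ {p = p} {q} disjoint =
  Empty-unique λ (x , x∈p∩q) → let x∈p , x∈q = x∈p∩q⁻ p q x∈p∩q in disjoint x∈p x∈q

p⊆[p─q]∪[p∩q] : p ⊆ (p ─ q) ∪ (p ∩ q)
p⊆[p─q]∪[p∩q] {q = q} {x} x∈p with x ∈? q
... | yes x∈q = x∈p∪q⁺ (inj₂ (x∈p∩q⁺ (x∈p , x∈q)))
... | no  x∉q = x∈p∪q⁺ (inj₁ (x∈p∧x∉q⇒x∈p─q x∈p x∉q))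

∪≡⊤⇒∈⊎ : ∀ {p q r s : Subset n} → p ∪ q ∪ r ∪ s ≡ ⊤ → ∀ x → x ∈ p ⊎ x ∈ q ⊎ x ∈ r ⊎ x ∈ s
∪≡⊤⇒∈⊎ {p = p} {q} {r} {s} cover x =
  Sum.map₂ (Sum.map₂ (x∈p∪q⁻ r s) ∘ x∈p∪q⁻ q (r ∪ s)) (x∈p∪q⁻ p _ (subst (x ∈_) (≡.sym cover) ∈⊤))

venn-cover : ∀ (p q : Subset n) → (p ─ q) ∪ (q ─ p) ∪ (p ∩ q) ∪ ∁ (p ∪ q) ≡ ⊤
venn-cover p q = ⊆-antisym ⊆⊤ λ {x} _ → cell x
  where
  cell : ∀ x → x ∈ (p ─ q) ∪ (q ─ p) ∪ (p ∩ q) ∪ ∁ (p ∪ q)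
  cell x with x ∈? p | x ∈? q
  ... | yes x∈p | yes x∈q = x∈p∪q⁺ (inj₂ (x∈p∪q⁺ (inj₂ (x∈p∪q⁺ (inj₁ (x∈p∩q⁺ (x∈p , x∈q)))))))
  ... | yes x∈p | no  x∉q = x∈p∪q⁺ (inj₁ (x∈p∧x∉q⇒x∈p─q x∈p x∉q))
  ... | no  x∉p | yes x∈q = x∈p∪q⁺ (inj₂ (x∈p∪q⁺ (inj₁ (x∈p∧x∉q⇒x∈p─q x∈q x∉p))))
  ... | no  x∉p | no  x∉q =
    x∈p∪q⁺ (inj₂ (x∈p∪q⁺ (inj₂ (x∈p∪q⁺ (inj₂ (x∉p⇒x∈∁p ([ x∉p , x∉q ]′ ∘ x∈p∪q⁻ p q)))))))

∣p∩q∣+∣p∪q∣≡∣p∣+∣q∣ : ∀ (p q : Subset n) → ∣ p ∩ q ∣ ℕ.+ ∣ p ∪ q ∣ ≡ ∣ p ∣ ℕ.+ ∣ q ∣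
∣p∩q∣+∣p∪q∣≡∣p∣+∣q∣ []            []            = refl
∣p∩q∣+∣p∪q∣≡∣p∣+∣q∣ (inside  ∷ p) (inside  ∷ q) =
  cong suc (trans (ℕ.+-suc _ _) (trans (cong suc (∣p∩q∣+∣p∪q∣≡∣p∣+∣q∣ p q)) (≡.sym (ℕ.+-suc _ _))))
∣p∩q∣+∣p∪q∣≡∣p∣+∣q∣ (inside  ∷ p) (outside ∷ q) =
  trans (ℕ.+-suc _ _) (cong suc (∣p∩q∣+∣p∪q∣≡∣p∣+∣q∣ p q))
∣p∩q∣+∣p∪q∣≡∣p∣+∣q∣ (outside ∷ p) (inside  ∷ q) =
  trans (ℕ.+-suc _ _) (trans (cong suc (∣p∩q∣+∣p∪q∣≡∣p∣+∣q∣ p q)) (≡.sym (ℕ.+-suc _ _)))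
∣p∩q∣+∣p∪q∣≡∣p∣+∣q∣ (outside ∷ p) (outside ∷ q) = ∣p∩q∣+∣p∪q∣≡∣p∣+∣q∣ p q

∣p─q∣+∣p∩q∣≡∣p∣ : ∀ (p q : Subset n) → ∣ p ─ q ∣ ℕ.+ ∣ p ∩ q ∣ ≡ ∣ p ∣
∣p─q∣+∣p∩q∣≡∣p∣ []            []            = refl
∣p─q∣+∣p∩q∣≡∣p∣ (inside  ∷ p) (inside  ∷ q) = trans (ℕ.+-suc _ _) (cong suc (∣p─q∣+∣p∩q∣≡∣p∣ p q))
∣p─q∣+∣p∩q∣≡∣p∣ (inside  ∷ p) (outside ∷ q) = cong suc (∣p─q∣+∣p∩q∣≡∣p∣ p q)
∣p─q∣+∣p∩q∣≡∣p∣ (outside ∷ p) (inside  ∷ q) = ∣p─q∣+∣p∩q∣≡∣p∣ p q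
∣p─q∣+∣p∩q∣≡∣p∣ (outside ∷ p) (outside ∷ q) = ∣p─q∣+∣p∩q∣≡∣p∣ p q

∣p∣≡∣q∣⇒∣p─q∣≡∣q─p∣ : ∀ (p q : Subset n) → ∣ p ∣ ≡ ∣ q ∣ → ∣ p ─ q ∣ ≡ ∣ q ─ p ∣
∣p∣≡∣q∣⇒∣p─q∣≡∣q─p∣ p q ∣p∣≡∣q∣ = ℕ.+-cancelʳ-≡ ∣ p ∩ q ∣ _ _ (begin
  ∣ p ─ q ∣ ℕ.+ ∣ p ∩ q ∣  ≡⟨ ∣p─q∣+∣p∩q∣≡∣p∣ p q ⟩
  ∣ p ∣                    ≡⟨ ∣p∣≡∣q∣ ⟩
  ∣ q ∣                    ≡⟨ ∣p─q∣+∣p∩q∣≡∣p∣ q p ⟨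
  ∣ q ─ p ∣ ℕ.+ ∣ q ∩ p ∣  ≡⟨ cong (λ r → ∣ q ─ p ∣ ℕ.+ ∣ r ∣) (∩-comm q p) ⟩
  ∣ q ─ p ∣ ℕ.+ ∣ p ∩ q ∣  ∎)
  where open ≡-Reasoning

∣p∣+∣∁p∣≡n : ∀ (p : Subset n) → ∣ p ∣ ℕ.+ ∣ ∁ p ∣ ≡ n
∣p∣+∣∁p∣≡n p = trans (cong (∣ p ∣ ℕ.+_) (∣∁p∣≡n∸∣p∣ p)) (ℕ.m+[n∸m]≡n (∣p∣≤n p))

p∩q≡⊥⇒∣p∪q∣≡∣p∣+∣q∣ : p ∩ q ≡ ⊥ → ∣ p ∪ q ∣ ≡ ∣ p ∣ ℕ.+ ∣ q ∣
p∩q≡⊥⇒∣p∪q∣≡∣p∣+∣q∣ {n} {p} {q} p∩q≡⊥ = begin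
  ∣ p ∪ q ∣                ≡⟨ cong (ℕ._+ ∣ p ∪ q ∣) (trans (cong ∣_∣ p∩q≡⊥) (∣⊥∣≡0 n)) ⟨
  ∣ p ∩ q ∣ ℕ.+ ∣ p ∪ q ∣  ≡⟨ ∣p∩q∣+∣p∪q∣≡∣p∣+∣q∣ p q ⟩
  ∣ p ∣ ℕ.+ ∣ q ∣          ∎
  where open ≡-Reasoning

venn-count : ∀ (p q : Subset n) → ∣ p ∣ ℕ.+ ∣ q ∣ ℕ.+ ∣ ∁ (p ∪ q) ∣ ≡ n ℕ.+ ∣ p ∩ q ∣
venn-count {n} p q = begin
  ∣ p ∣ ℕ.+ ∣ q ∣ ℕ.+ ∣ ∁ (p ∪ q) ∣            ≡⟨ cong (ℕ._+ ∣ ∁ (p ∪ q) ∣) (∣p∩q∣+∣p∪q∣≡∣p∣+∣q∣ p q) ⟨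
  ∣ p ∩ q ∣ ℕ.+ ∣ p ∪ q ∣ ℕ.+ ∣ ∁ (p ∪ q) ∣    ≡⟨ ℕ.+-assoc ∣ p ∩ q ∣ _ _ ⟩
  ∣ p ∩ q ∣ ℕ.+ (∣ p ∪ q ∣ ℕ.+ ∣ ∁ (p ∪ q) ∣)  ≡⟨ cong (∣ p ∩ q ∣ ℕ.+_) (∣p∣+∣∁p∣≡n (p ∪ q)) ⟩
  ∣ p ∩ q ∣ ℕ.+ n                              ≡⟨ ℕ.+-comm ∣ p ∩ q ∣ n ⟩
  n ℕ.+ ∣ p ∩ q ∣                              ∎
  where open ≡-Reasoning

extend-to-size : ∀ (p : Subset n) {k} → ∣ p ∣ ≤ k → k ≤ n → ∃ λ q → p ⊆ q × ∣ q ∣ ≡ k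
extend-to-size []            z≤n       z≤n       = [] , id , refl
extend-to-size (inside  ∷ p) (s≤s p≤k) (s≤s k≤n) =
  let q , p⊆q , ∣q∣≡k = extend-to-size p p≤k k≤n in inside ∷ q , s⊆s p⊆q , cong suc ∣q∣≡k
extend-to-size {suc n} (outside ∷ p) {k} p≤k k≤1+n with k ℕ.≤? n
... | yes k≤n = let q , p⊆q , ∣q∣≡k = extend-to-size p p≤k k≤n in outside ∷ q , s⊆s p⊆q , ∣q∣≡k
... | no  k≰n = ⊤ , ⊆⊤ , trans (∣⊤∣≡n (suc n)) (≡.sym (ℕ.≤-antisym k≤1+n (ℕ.≰⇒> k≰n)))

argmin : ∀ (f : Subset n → ℕ) → ∃ λ W → ∀ W′ → f W ≤ f W′
argmin {zero}  f = [] , λ { [] → ℕ.≤-refl }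
argmin {suc n} f with argmin (f ∘ (inside ∷_)) | argmin (f ∘ (outside ∷_))
... | Wᵢ , minᵢ | Wₒ , minₒ with ℕ.≤-total (f (inside ∷ Wᵢ)) (f (outside ∷ Wₒ))
... | inj₁ i≤o = inside ∷ Wᵢ , λ { (inside ∷ W) → minᵢ W ; (outside ∷ W) → ℕ.≤-trans i≤o (minₒ W) }
... | inj₂ o≤i = outside ∷ Wₒ , λ { (inside ∷ W) → ℕ.≤-trans o≤i (minᵢ W) ; (outside ∷ W) → minₒ W }

anyF⁺ : ∀ (f : Fin n → Bool) i → f i ≡ true → anyF f ≡ true
anyF⁺ f zero    fi = cong (_∨ anyF (f ∘ suc)) fi
anyF⁺ f (suc i) fi = trans (cong (f zero ∨_) (anyF⁺ (f ∘ suc) i fi)) (∨-zeroʳ (f zero))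

anyF⁻ : ∀ (f : Fin n → Bool) → anyF f ≡ true → ∃ λ i → f i ≡ true
anyF⁻ {suc n} f e with f zero in f0
... | true  = zero , f0
... | false = let i , fi = anyF⁻ (f ∘ suc) e in suc i , fi

∧≡true⁻ : ∀ {a b} → a ∧ b ≡ true → a ≡ true × b ≡ true
∧≡true⁻ {true} b≡true = refl , b≡true

module _ (G : Graph n) where

  ∈N⁺ : ∀ {X x y} → x ∈ X → adj G x y ≡ true → y ∈ N G X
  ∈N⁺ {X} {x} {y} x∈X xy = lookup⇒[]= y (N G X)
    (trans (lookup∘tabulate _ y) (anyF⁺ _ x (cong₂ _∧_ ([]=⇒lookup x∈X) xy)))

  ∈N⁻ : ∀ {X y} → y ∈ N G X → ∃ λ x → x ∈ X × adj G x y ≡ true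
  ∈N⁻ {X} {y} y∈NX =
    let x , e = anyF⁻ _ (trans (≡.sym (lookup∘tabulate _ y)) ([]=⇒lookup y∈NX))
        X[x] , xy = ∧≡true⁻ e
    in x , lookup⇒[]= x X X[x] , xy

  N-mono : ∀ {X Y} → X ⊆ Y → N G X ⊆ N G Y
  N-mono X⊆Y y∈NX = let x , x∈X , xy = ∈N⁻ y∈NX in ∈N⁺ (X⊆Y x∈X) xy

-- Shooting W₁ and then W₂ catches the rabbit: R₂ = N(V ∖ W₁) ∖ W₂ = ∅.
Catches : Graph n → Subset n → Subset n → Set
Catches G W₁ W₂ = N G (∁ W₁) ⊆ W₂

record BalancedCatch (G : Graph n) (k : ℕ) : Set where
  constructor balanced
  field
    W₁ W₂   : Subset n
    ∣W₁∣≡k  : ∣ W₁ ∣ ≡ k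
    ∣W₂∣≡k  : ∣ W₂ ∣ ≡ k
    catches : Catches G W₁ W₂

module _ (G : Graph n) where

  Catches-sym : ∀ {W₁ W₂} → Catches G W₁ W₂ → Catches G W₂ W₁
  Catches-sym {W₁} c {y} y∈N[∁W₂] with ∈N⁻ G y∈N[∁W₂] | y ∈? W₁
  ... | _ | yes y∈W₁ = y∈W₁
  ... | x , x∈∁W₂ , xy | no y∉W₁ =
    contradiction (c (∈N⁺ G (x∉p⇒x∈∁p y∉W₁) (trans (sym G y x) xy))) (x∈∁p⇒x∉p x∈∁W₂)

  Catches-mono : ∀ {W₁ W₁′ W₂ W₂′} → W₁ ⊆ W₁′ → W₂ ⊆ W₂′ → Catches G W₁ W₂ → Catches G W₁′ W₂′
  Catches-mono W₁⊆W₁′ W₂⊆W₂′ c y∈ = W₂⊆W₂′ (c (N-mono G (p⊆q⇒∁p⊇∁q W₁⊆W₁′) y∈))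

  catches⇒wins : ∀ {W₁ W₂ k} → ∣ W₁ ∣ ≤ k → ∣ W₂ ∣ ≤ k → Catches G W₁ W₂ → HunterWins G 2 k
  catches⇒wins {W₁} {W₂} ∣W₁∣≤k ∣W₂∣≤k c = W₁ , (W₂ ∷ []) , ∣W₁∣≤k , (∣W₂∣≤k ∷ []) , p⊆q⇒p─q≡⊥ c

  wins⇒catches : ∀ {k} → HunterWins G 2 k → ∃₂ λ W₁ W₂ → ∣ W₁ ∣ ≤ k × ∣ W₂ ∣ ≤ k × Catches G W₁ W₂
  wins⇒catches (W₁ , (W₂ ∷ []) , ∣W₁∣≤k , (∣W₂∣≤k ∷ []) , R₂≡⊥) =
    W₁ , W₂ , ∣W₁∣≤k , ∣W₂∣≤k , p─q≡⊥⇒p⊆q R₂≡⊥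

  -- After a first shot W, the best second shot is N(V ∖ W) itself.
  cost : Subset n → ℕ
  cost W = ∣ W ∣ ⊔ ∣ N G (∁ W) ∣

  wins⇒cost≤ : ∀ {k} → HunterWins G 2 k → ∃ λ W → cost W ≤ k
  wins⇒cost≤ w =
    let W₁ , W₂ , ∣W₁∣≤k , ∣W₂∣≤k , c = wins⇒catches w
    in W₁ , ℕ.⊔-lub ∣W₁∣≤k (ℕ.≤-trans (p⊆q⇒∣p∣≤∣q∣ c) ∣W₂∣≤k)

  optimal-shot : Subset n
  optimal-shot = proj₁ (argmin cost)

  h₂ : ℕ
  h₂ = cost optimal-shot

  h₂-isH : IsH G 2 h₂
  h₂-isH = catches⇒wins {optimal-shot} (ℕ.m≤m⊔n _ _) (ℕ.m≤n⊔m _ _) id , least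
    where
    least : ∀ k → HunterWins G 2 k → h₂ ≤ k
    least k w = let W , cost≤k = wins⇒cost≤ w in ℕ.≤-trans (proj₂ (argmin cost) W) cost≤k

  h₂≤n : h₂ ≤ n
  h₂≤n = proj₂ h₂-isH n (catches⇒wins {⊤} {⊤} ∣⊤∣≤n ∣⊤∣≤n ⊆⊤)
    where ∣⊤∣≤n = ℕ.≤-reflexive (∣⊤∣≡n n)

  balance : ∀ {k} → HunterWins G 2 k → k ≤ n → BalancedCatch G k
  balance w k≤n =
    let W₁ , W₂ , ∣W₁∣≤k , ∣W₂∣≤k , c = wins⇒catches w
        V₁ , W₁⊆V₁ , ∣V₁∣≡k = extend-to-size W₁ ∣W₁∣≤k k≤n
        V₂ , W₂⊆V₂ , ∣V₂∣≡k = extend-to-size W₂ ∣W₂∣≤k k≤n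
    in balanced V₁ V₂ ∣V₁∣≡k ∣V₂∣≡k (Catches-mono W₁⊆V₁ W₂⊆V₂ c)

  balanced⇒h₂≤ : ∀ {k} → BalancedCatch G k → h₂ ≤ k
  balanced⇒h₂≤ {k} (balanced W₁ W₂ ∣W₁∣≡k ∣W₂∣≡k c) =
    proj₂ h₂-isH k (catches⇒wins {W₁} {W₂} (ℕ.≤-reflexive ∣W₁∣≡k) (ℕ.≤-reflexive ∣W₂∣≡k) c)

module _ {G : Graph n} {k} (bc : BalancedCatch G k) where
  open BalancedCatch bc

  balanced-count : k ℕ.+ k ℕ.+ ∣ ∁ (W₁ ∪ W₂) ∣ ≡ n ℕ.+ ∣ W₁ ∩ W₂ ∣
  balanced-count =
    trans (cong₂ (λ i j → i ℕ.+ j ℕ.+ ∣ ∁ (W₁ ∪ W₂) ∣) (≡.sym ∣W₁∣≡k) (≡.sym ∣W₂∣≡k)) (venn-count W₁ W₂)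

  cells-BSSPartition : BSSPartition G (W₁ ─ W₂) (W₂ ─ W₁) (W₁ ∩ W₂) (∁ (W₁ ∪ W₂))
  cells-BSSPartition =
      disjoint⇒p∩q≡⊥ (λ a b → x∈p─q⇒x∉q a (p─q⊆p W₂ W₁ b))
    , disjoint⇒p∩q≡⊥ (λ a c → x∈p─q⇒x∉q a (p∩q⊆q W₁ W₂ c))
    , disjoint⇒p∩q≡⊥ (λ a d → x∈∁p⇒x∉p (D⊆∁W₁ d) (p─q⊆p W₁ W₂ a))
    , disjoint⇒p∩q≡⊥ (λ b c → x∈p─q⇒x∉q b (p∩q⊆p W₁ W₂ c))
    , disjoint⇒p∩q≡⊥ (λ b d → x∈∁p⇒x∉p (D⊆∁W₂ d) (p─q⊆p W₂ W₁ b))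
    , disjoint⇒p∩q≡⊥ (λ c d → x∈∁p⇒x∉p (D⊆∁W₁ d) (p∩q⊆p W₁ W₂ c))
    , venn-cover W₁ W₂
    , ∣p∣≡∣q∣⇒∣p─q∣≡∣q─p∣ W₁ W₂ (trans ∣W₁∣≡k (≡.sym ∣W₂∣≡k))
    , (λ y∈ → x∈p∩q⁺ (catches′ (N-mono G D⊆∁W₂ y∈) , catches (N-mono G D⊆∁W₁ y∈)))
    , (λ y∈ → p⊆[p─q]∪[p∩q] (catches′ (N-mono G A⊆∁W₂ y∈)))
    , (λ {y} y∈ → subst (λ C → y ∈ (W₂ ─ W₁) ∪ C) (∩-comm W₂ W₁)
                    (p⊆[p─q]∪[p∩q] (catches (N-mono G B⊆∁W₁ y∈))))
    where
    catches′ : Catches G W₂ W₁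
    catches′ = Catches-sym G catches
    A⊆∁W₂ : W₁ ─ W₂ ⊆ ∁ W₂
    A⊆∁W₂ = p─q⊆∁q
    B⊆∁W₁ : W₂ ─ W₁ ⊆ ∁ W₁
    B⊆∁W₁ = p─q⊆∁q
    D⊆∁W₁ : ∁ (W₁ ∪ W₂) ⊆ ∁ W₁
    D⊆∁W₁ = p⊆q⇒∁p⊇∁q (p⊆p∪q W₂)
    D⊆∁W₂ : ∁ (W₁ ∪ W₂) ⊆ ∁ W₂
    D⊆∁W₂ = p⊆q⇒∁p⊇∁q (q⊆p∪q W₁ W₂)

module _ (G : Graph n) (A B C D : Subset n) where

  partition-balanced : BSSPartition G A B C D → BalancedCatch G (∣ A ∣ ℕ.+ ∣ C ∣)
  partition-balanced (_ , A∩C≡⊥ , _ , B∩C≡⊥ , _ , _ , cover , ∣A∣≡∣B∣ , ND⊆C , _ , NB⊆B∪C) =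
    balanced (A ∪ C) (B ∪ C) (p∩q≡⊥⇒∣p∪q∣≡∣p∣+∣q∣ A∩C≡⊥)
      (trans (p∩q≡⊥⇒∣p∪q∣≡∣p∣+∣q∣ B∩C≡⊥) (cong (ℕ._+ ∣ C ∣) (≡.sym ∣A∣≡∣B∣))) catches
    where
    catches : Catches G (A ∪ C) (B ∪ C)
    catches y∈ with ∈N⁻ G y∈
    ... | x , x∈∁[A∪C] , xy with ∪≡⊤⇒∈⊎ cover x
    ... | inj₁ x∈A               = contradiction (x∈p∪q⁺ (inj₁ x∈A)) (x∈∁p⇒x∉p x∈∁[A∪C])
    ... | inj₂ (inj₁ x∈B)        = NB⊆B∪C (∈N⁺ G x∈B xy)
    ... | inj₂ (inj₂ (inj₁ x∈C)) = contradiction (x∈p∪q⁺ (inj₂ x∈C)) (x∈∁p⇒x∉p x∈∁[A∪C])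
    ... | inj₂ (inj₂ (inj₂ x∈D)) = x∈p∪q⁺ (inj₂ (ND⊆C (∈N⁺ G x∈D xy)))

  partition-bound : BSSPartition G A B C D → h₂ G ℕ.+ h₂ G ℕ.+ ∣ D ∣ ≤ n ℕ.+ ∣ C ∣
  partition-bound P@(A∩B≡⊥ , _ , A∩D≡⊥ , _ , B∩D≡⊥ , C∩D≡⊥ , _) = begin
    h₂ G ℕ.+ h₂ G ℕ.+ ∣ D ∣                ≤⟨ ℕ.+-mono-≤ (ℕ.+-mono-≤ h≤k h≤k) (p⊆q⇒∣p∣≤∣q∣ D⊆D′) ⟩
    k ℕ.+ k ℕ.+ ∣ ∁ ((A ∪ C) ∪ (B ∪ C)) ∣  ≡⟨ balanced-count bc ⟩
    n ℕ.+ ∣ (A ∪ C) ∩ (B ∪ C) ∣            ≤⟨ ℕ.+-monoʳ-≤ n (p⊆q⇒∣p∣≤∣q∣ C′⊆C) ⟩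
    n ℕ.+ ∣ C ∣                            ∎
    where
    open ℕ.≤-Reasoning
    k = ∣ A ∣ ℕ.+ ∣ C ∣
    bc = partition-balanced P
    h≤k = balanced⇒h₂≤ G bc
    C′⊆C : (A ∪ C) ∩ (B ∪ C) ⊆ C
    C′⊆C x∈C′ with x∈p∩q⁻ (A ∪ C) (B ∪ C) x∈C′
    ... | x∈A∪C , x∈B∪C with x∈p∪q⁻ A C x∈A∪C | x∈p∪q⁻ B C x∈B∪C
    ... | inj₂ x∈C | _        = x∈C
    ... | inj₁ _   | inj₂ x∈C = x∈C
    ... | inj₁ x∈A | inj₁ x∈B = contradiction x∈B (p∩q≡⊥∧x∈p⇒x∉q A∩B≡⊥ x∈A)
    D⊆D′ : D ⊆ ∁ ((A ∪ C) ∪ (B ∪ C))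
    D⊆D′ {x} x∈D = x∉p⇒x∈∁p
      ([ [ ∉D A∩D≡⊥ , ∉D C∩D≡⊥ ]′ ∘ x∈p∪q⁻ A C , [ ∉D B∩D≡⊥ , ∉D C∩D≡⊥ ]′ ∘ x∈p∪q⁻ B C ]′
         ∘ x∈p∪q⁻ (A ∪ C) (B ∪ C))
      where
      ∉D : ∀ {X} → X ∩ D ≡ ⊥ → x ∉ X
      ∉D X∩D≡⊥ x∈X = p∩q≡⊥∧x∈p⇒x∉q X∩D≡⊥ x∈X x∈D

m+q≤o+p⇒m-o≤p-q : ∀ m o p q → m ℕ.+ q ≤ o ℕ.+ p → + m - + o ℤ.≤ + p - + q
m+q≤o+p⇒m-o≤p-q m o p q m+q≤o+p = begin
  + m - + o              ≡⟨ ℤ.[+m]-[+n]≡m⊖n m o ⟩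
  m ⊖ o                  ≡⟨ ℤ.+-cancelˡ-⊖ q m o ⟨
  (q ℕ.+ m) ⊖ (q ℕ.+ o)  ≤⟨ ℤ.⊖-monoˡ-≤ (q ℕ.+ o) (subst (_≤ o ℕ.+ p) (ℕ.+-comm m q) m+q≤o+p) ⟩
  (o ℕ.+ p) ⊖ (q ℕ.+ o)  ≡⟨ cong ((o ℕ.+ p) ⊖_) (ℕ.+-comm q o) ⟩
  (o ℕ.+ p) ⊖ (o ℕ.+ q)  ≡⟨ ℤ.+-cancelˡ-⊖ o p q ⟩
  p ⊖ q                  ≡⟨ ℤ.[+m]-[+n]≡m⊖n p q ⟨
  + p - + q              ∎
  where open ℤ.≤-Reasoning

m+q≡o+p⇒p-q≡m-o : ∀ m o p q → m ℕ.+ q ≡ o ℕ.+ p → + p - + q ≡ + m - + o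
m+q≡o+p⇒p-q≡m-o m o p q m+q≡o+p = ℤ.≤-antisym
  (m+q≤o+p⇒m-o≤p-q p q m o (ℕ.≤-reflexive (trans (ℕ.+-comm p o) (trans (≡.sym m+q≡o+p) (ℕ.+-comm m q)))))
  (m+q≤o+p⇒m-o≤p-q m o p q (ℕ.≤-reflexive m+q≡o+p))

h+h+q≡n+p⇒2h≡n+[p-q] : ∀ h n p q → h ℕ.+ h ℕ.+ q ≡ n ℕ.+ p → + 2 * + h ≡ + n + (+ p - + q)
h+h+q≡n+p⇒2h≡n+[p-q] h n p q h+h+q≡n+p = begin
  + 2 * + h                  ≡⟨ ℤ.pos-* 2 h ⟨
  + (h ℕ.+ (h ℕ.+ 0))        ≡⟨ cong (λ m → + (h ℕ.+ m)) (ℕ.+-identityʳ h) ⟩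
  + (h ℕ.+ h)                ≡⟨ cong +_ (ℕ.m+n∸m≡n n (h ℕ.+ h)) ⟨
  + (n ℕ.+ (h ℕ.+ h) ℕ.∸ n)  ≡⟨ ℤ.⊖-≥ (ℕ.m≤m+n n (h ℕ.+ h)) ⟨
  (n ℕ.+ (h ℕ.+ h)) ⊖ n      ≡⟨ ℤ.distribʳ-⊖-+-pos n (h ℕ.+ h) n ⟨
  + n + ((h ℕ.+ h) ⊖ n)      ≡⟨ cong (_+_ (+ n)) (ℤ.[+m]-[+n]≡m⊖n (h ℕ.+ h) n) ⟨
  + n + (+ (h ℕ.+ h) - + n)  ≡⟨ cong (_+_ (+ n)) (m+q≡o+p⇒p-q≡m-o (h ℕ.+ h) n p q h+h+q≡n+p) ⟨
  + n + (+ p - + q)          ∎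
  where open ≡-Reasoning

lemma6 : (n : ℕ) → (G : Graph n) →
    Σ ℕ λ h → Σ ℤ λ b → IsH G 2 h × IsBSS G b × (+ 2 * + h ≡ + n + b)
lemma6 n G = h , + ∣ C ∣ - + ∣ D ∣ , h₂-isH G , (value , least) , h+h+q≡n+p⇒2h≡n+[p-q] h n ∣ C ∣ ∣ D ∣ count
  where
  h = h₂ G
  optimal : BalancedCatch G h
  optimal = balance G (proj₁ (h₂-isH G)) (h₂≤n G)
  open BalancedCatch optimal
  C D : Subset n
  C = W₁ ∩ W₂
  D = ∁ (W₁ ∪ W₂)
  count : h ℕ.+ h ℕ.+ ∣ D ∣ ≡ n ℕ.+ ∣ C ∣
  count = balanced-count optimal
  value : BSSValue G (+ ∣ C ∣ - + ∣ D ∣)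
  value = W₁ ─ W₂ , W₂ ─ W₁ , C , D , cells-BSSPartition optimal , refl
  least : ∀ m → BSSValue G m → + ∣ C ∣ - + ∣ D ∣ ℤ.≤ m
  least _ (A′ , B′ , C′ , D′ , P , refl) = ℤ.≤-trans
    (ℤ.≤-reflexive (m+q≡o+p⇒p-q≡m-o (h ℕ.+ h) n ∣ C ∣ ∣ D ∣ count))
    (m+q≤o+p⇒m-o≤p-q (h ℕ.+ h) n ∣ C′ ∣ ∣ D′ ∣ (partition-bound G A′ B′ C′ D′ P))
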